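{- Let $L$ be a Lie algebra and $m\ge 1$. (1) The sentence $$\forall u_1,v_1,\dots,u_{m+1},v_{m+1}\ \exists u_1',v_1',\dots,u_m',v_m'\ \Big(\sum_{i=1}^{m+1}u_iv_i=\sum_{j=1}^m u_j'v_j'\Big)$$ holds in $L$ if and only if $L^2$ has finite width and its width is at most $m$. (2) Consider the formula $$\psi_m(a_1,\dots,a_m)=\forall u_1,v_1,\dots,u_{m+1},v_{m+1}\ \exists v_1',\dots,v_m'\ \Big(\sum_{i=1}^{m+1}u_iv_i=\sum_{j=1}^m a_jv_j'\Big).$$ If $L$ is generated as an algebra by elements $u_1,\dots,u_m$, then $\psi_m(u_1,\dots,u_m)$ holds in $L$. Furthermore, suppose $\psi_m(a_1,\dots,a_m)$ holds in an arbitrary Lie algebra $L$ for some elements $a_1,\dots,a_m$. Then $L^2$ has width at most $m$, and $L^2$ is defined in $L$ by the formula $$S_m(y)=\exists a_1,\dots,a_m\ \exists v_1,\dots,v_m\ \Big(\psi_m(a_1,\dots,a_m)\wedge y=\sum_{i=1}^m a_iv_i\Big).$$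
   Context: $L^2$ denotes the additive subgroup (submodule) of $L$ generated by all products $uv$ with $u,v\in L$. $L^2$ has finite width if there is $m$ such that every element of $L^2$ equals $u_1v_1+\dots+u_mv_m$ for some $u_i,v_i\in L$. The least such $m$ is the width. -}

module Defs where

open import Level using (Level; _⊔_)
open import Data.Nat using (ℕ; zero; suc; _≤_)
open import Data.Fin using (Fin; zero; suc)
open import Data.Product using (Σ; _×_; _,_)
open import Algebra.Bundles using (CommutativeRing)
open import Algebra.Module.Bundles using (Module)

record LieAlgebra {r ℓr : Level} (R : CommutativeRing r ℓr) (m ℓm : Level)
       : Set (r ⊔ ℓr ⊔ Level.suc (m ⊔ ℓm)) where
  open CommutativeRing R using () renaming (Carrier to Scalar)
  field
    module' : Module R m ℓm
  open Module module' public
  field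
    [_,_]      : Carrierᴹ → Carrierᴹ → Carrierᴹ
    [,]-cong   : ∀ {x x′ y y′} → x ≈ᴹ x′ → y ≈ᴹ y′ → [ x , y ] ≈ᴹ [ x′ , y′ ]
    [,]-+ˡ     : ∀ x y z → [ x +ᴹ y , z ] ≈ᴹ [ x , z ] +ᴹ [ y , z ]
    [,]-+ʳ     : ∀ x y z → [ x , y +ᴹ z ] ≈ᴹ [ x , y ] +ᴹ [ x , z ]
    [,]-*ˡ     : ∀ (c : Scalar) x y → [ c *ₗ x , y ] ≈ᴹ c *ₗ [ x , y ]
    [,]-*ʳ     : ∀ (c : Scalar) x y → [ x , c *ₗ y ] ≈ᴹ c *ₗ [ x , y ]
    [,]-alt    : ∀ x → [ x , x ] ≈ᴹ 0ᴹ
    jacobi     : ∀ x y z →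
                 [ x , [ y , z ] ] +ᴹ [ y , [ z , x ] ] +ᴹ [ z , [ x , y ] ] ≈ᴹ 0ᴹ

module _ {r ℓr m ℓm : Level} {R : CommutativeRing r ℓr} (L : LieAlgebra R m ℓm) where
  open LieAlgebra L
  open CommutativeRing R using () renaming (Carrier to Scalar)

  sumProd : (n : ℕ) → (Fin n → Carrierᴹ) → (Fin n → Carrierᴹ) → Carrierᴹ
  sumProd zero    u v = 0ᴹ
  sumProd (suc n) u v = [ u zero , v zero ] +ᴹ sumProd n (λ i → u (suc i)) (λ i → v (suc i))

  data InL2 : Carrierᴹ → Set (m ⊔ ℓm) where
    l2-prod : ∀ u v → InL2 [ u , v ]
    l2-zero : InL2 0ᴹ
    l2-add  : ∀ {x y} → InL2 x → InL2 y → InL2 (x +ᴹ y)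
    l2-neg  : ∀ {x} → InL2 x → InL2 (-ᴹ x)
    l2-resp : ∀ {x y} → x ≈ᴹ y → InL2 x → InL2 y

  WidthBound : ℕ → Set (m ⊔ ℓm)
  WidthBound k = ∀ x → InL2 x →
    Σ (Fin k → Carrierᴹ) λ u → Σ (Fin k → Carrierᴹ) λ v → x ≈ᴹ sumProd k u v

  WidthAtMost : ℕ → Set (m ⊔ ℓm)
  WidthAtMost n = Σ ℕ λ k → k ≤ n × WidthBound k

  Sentence : ℕ → Set (m ⊔ ℓm)
  Sentence n = (u v : Fin (suc n) → Carrierᴹ) →
    Σ (Fin n → Carrierᴹ) λ u′ → Σ (Fin n → Carrierᴹ) λ v′ →
      sumProd (suc n) u v ≈ᴹ sumProd n u′ v′

  ψ : (n : ℕ) → (Fin n → Carrierᴹ) → Set (m ⊔ ℓm)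
  ψ n a = (u v : Fin (suc n) → Carrierᴹ) →
    Σ (Fin n → Carrierᴹ) λ v′ → sumProd (suc n) u v ≈ᴹ sumProd n a v′

  S : (n : ℕ) → Carrierᴹ → Set (m ⊔ ℓm)
  S n y = Σ (Fin n → Carrierᴹ) λ a → Σ (Fin n → Carrierᴹ) λ v →
    ψ n a × y ≈ᴹ sumProd n a v

  data InSubalg {n : ℕ} (g : Fin n → Carrierᴹ) : Carrierᴹ → Set (r ⊔ m ⊔ ℓm) where
    sa-gen   : ∀ i → InSubalg g (g i)
    sa-zero  : InSubalg g 0ᴹ
    sa-add   : ∀ {x y} → InSubalg g x → InSubalg g y → InSubalg g (x +ᴹ y)
    sa-neg   : ∀ {x} → InSubalg g x → InSubalg g (-ᴹ x)
    sa-scal  : ∀ (c : Scalar) {x} → InSubalg g x → InSubalg g (c *ₗ x)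
    sa-br    : ∀ {x y} → InSubalg g x → InSubalg g y → InSubalg g [ x , y ]
    sa-resp  : ∀ {x y} → x ≈ᴹ y → InSubalg g x → InSubalg g y

  GeneratedBy : {n : ℕ} → (Fin n → Carrierᴹ) → Set (r ⊔ m ⊔ ℓm)
  GeneratedBy g = ∀ x → InSubalg g x

-- (1) If any n + 1 products can be traded for n, then absorbing the products of
-- an element of L² one at a time into a sum of n products shows that L² has
-- width at most n; conversely a sum of n + 1 products lies in L².
-- (2) If L is generated by g, every [x , y] lies in [g₁ , L] + ⋯ + [gₙ , L]:
-- this set contains the [gᵢ , y], and by the Jacobi identity
-- [[a , b] , y] = [a , [b , y]] + [b , [y , a]] it is closed under the
-- operations building x from the generators. If ψₙ(a) holds, every sum of
-- n + 1 products is a sum of n products of the special form Σ [aᵢ , vᵢ], so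
-- part (1) bounds the width and every element of L² satisfies Sₙ.
module Submission where

open import Defs
open import Level using (Level)
open import Data.Nat using (ℕ; _≤_; zero; suc)
open import Data.Nat.Properties using (≤⇒≤′; ≤-refl)
open import Data.Nat.Base using (_≤′_; ≤′-refl; ≤′-step)
open import Data.Fin using (Fin; zero; suc)
open import Data.Product using (_×_; Σ; _,_)
open import Data.Vec.Functional using (_∷_; head; tail)
open import Function.Bundles using (_⇔_; mk⇔)
open import Algebra.Bundles using (CommutativeRing; AbelianGroup)
import Algebra.Properties.AbelianGroup as AbelianGroupProperties
import Algebra.Properties.CommutativeSemigroup as CommutativeSemigroupProperties
import Relation.Binary.Reasoning.Setoid as SetoidReasoning

module _ {r ℓr m ℓm : Level} {R : CommutativeRing r ℓr} (L : LieAlgebra R m ℓm) where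
  open LieAlgebra L
  open AbelianGroupProperties +ᴹ-abelianGroup
  open CommutativeSemigroupProperties
    (AbelianGroup.commutativeSemigroup +ᴹ-abelianGroup) using (interchange)
  open SetoidReasoning ≈ᴹ-setoid

  [,]-zeroˡ : ∀ v → [ 0ᴹ , v ] ≈ᴹ 0ᴹ
  [,]-zeroˡ v = identityˡ-unique _ _
    (≈ᴹ-trans (≈ᴹ-sym ([,]-+ˡ 0ᴹ 0ᴹ v)) ([,]-cong (+ᴹ-identityˡ 0ᴹ) ≈ᴹ-refl))

  [,]-zeroʳ : ∀ u → [ u , 0ᴹ ] ≈ᴹ 0ᴹ
  [,]-zeroʳ u = identityˡ-unique _ _
    (≈ᴹ-trans (≈ᴹ-sym ([,]-+ʳ u 0ᴹ 0ᴹ)) ([,]-cong ≈ᴹ-refl (+ᴹ-identityˡ 0ᴹ)))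

  -ᴹ‿distribˡ-[,] : ∀ u v → [ -ᴹ u , v ] ≈ᴹ -ᴹ [ u , v ]
  -ᴹ‿distribˡ-[,] u v = inverseʳ-unique [ u , v ] [ -ᴹ u , v ] (begin
    [ u , v ] +ᴹ [ -ᴹ u , v ] ≈⟨ [,]-+ˡ u (-ᴹ u) v ⟨
    [ u +ᴹ -ᴹ u , v ]         ≈⟨ [,]-cong (-ᴹ‿inverseʳ u) ≈ᴹ-refl ⟩
    [ 0ᴹ , v ]                ≈⟨ [,]-zeroˡ v ⟩
    0ᴹ                        ∎)

  -ᴹ‿distribʳ-[,] : ∀ u v → [ u , -ᴹ v ] ≈ᴹ -ᴹ [ u , v ]
  -ᴹ‿distribʳ-[,] u v = inverseʳ-unique [ u , v ] [ u , -ᴹ v ] (begin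
    [ u , v ] +ᴹ [ u , -ᴹ v ] ≈⟨ [,]-+ʳ u v (-ᴹ v) ⟨
    [ u , v +ᴹ -ᴹ v ]         ≈⟨ [,]-cong ≈ᴹ-refl (-ᴹ‿inverseʳ v) ⟩
    [ u , 0ᴹ ]                ≈⟨ [,]-zeroʳ u ⟩
    0ᴹ                        ∎)

  [,]-anticomm : ∀ x y → [ x , y ] ≈ᴹ -ᴹ [ y , x ]
  [,]-anticomm x y = inverseˡ-unique [ x , y ] [ y , x ] (begin
    [ x , y ] +ᴹ [ y , x ]
      ≈⟨ +ᴹ-cong (≈ᴹ-sym (+ᴹ-identityˡ _)) (≈ᴹ-sym (+ᴹ-identityʳ _)) ⟩
    (0ᴹ +ᴹ [ x , y ]) +ᴹ ([ y , x ] +ᴹ 0ᴹ)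
      ≈⟨ +ᴹ-cong (+ᴹ-congʳ ([,]-alt x)) (+ᴹ-congˡ ([,]-alt y)) ⟨
    ([ x , x ] +ᴹ [ x , y ]) +ᴹ ([ y , x ] +ᴹ [ y , y ])
      ≈⟨ +ᴹ-cong ([,]-+ʳ x x y) ([,]-+ʳ y x y) ⟨
    [ x , x +ᴹ y ] +ᴹ [ y , x +ᴹ y ] ≈⟨ [,]-+ˡ x y (x +ᴹ y) ⟨
    [ x +ᴹ y , x +ᴹ y ]              ≈⟨ [,]-alt _ ⟩
    0ᴹ                               ∎)

  [[,],]-jacobi : ∀ a b y → [ [ a , b ] , y ] ≈ᴹ [ a , [ b , y ] ] +ᴹ [ b , [ y , a ] ]
  [[,],]-jacobi a b y = begin
    [ [ a , b ] , y ]    ≈⟨ [,]-anticomm _ _ ⟩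
    -ᴹ [ y , [ a , b ] ] ≈⟨ -ᴹ‿cong (inverseʳ-unique _ _ (jacobi a b y)) ⟩
    -ᴹ (-ᴹ ([ a , [ b , y ] ] +ᴹ [ b , [ y , a ] ])) ≈⟨ ⁻¹-involutive _ ⟩
    [ a , [ b , y ] ] +ᴹ [ b , [ y , a ] ] ∎

  [-,]≈[,-] : ∀ u v → [ -ᴹ u , v ] ≈ᴹ [ u , -ᴹ v ]
  [-,]≈[,-] u v = ≈ᴹ-trans (-ᴹ‿distribˡ-[,] u v) (≈ᴹ-sym (-ᴹ‿distribʳ-[,] u v))

  [*ₗ,]≈[,*ₗ] : ∀ c u v → [ c *ₗ u , v ] ≈ᴹ [ u , c *ₗ v ]
  [*ₗ,]≈[,*ₗ] c u v = ≈ᴹ-trans ([,]-*ˡ c u v) (≈ᴹ-sym ([,]-*ʳ c u v))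

  private
    sP = sumProd L

  sumProd-InL2 : ∀ k u v → InL2 L (sP k u v)
  sumProd-InL2 zero    u v = l2-zero
  sumProd-InL2 (suc k) u v = l2-add (l2-prod _ _) (sumProd-InL2 k _ _)

  sumProd-zeroʳ : ∀ k u → sP k u (λ _ → 0ᴹ) ≈ᴹ 0ᴹ
  sumProd-zeroʳ zero    u = ≈ᴹ-refl
  sumProd-zeroʳ (suc k) u =
    ≈ᴹ-trans (+ᴹ-cong ([,]-zeroʳ _) (sumProd-zeroʳ k (tail u))) (+ᴹ-identityˡ 0ᴹ)

  sumProd-+ʳ : ∀ k u v w → sP k u v +ᴹ sP k u w ≈ᴹ sP k u (λ i → v i +ᴹ w i)
  sumProd-+ʳ zero    u v w = +ᴹ-identityˡ 0ᴹ
  sumProd-+ʳ (suc k) u v w = ≈ᴹ-trans (interchange _ _ _ _)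
    (+ᴹ-cong (≈ᴹ-sym ([,]-+ʳ _ _ _)) (sumProd-+ʳ k (tail u) (tail v) (tail w)))

  -ᴹ‿distribˡ-sumProd : ∀ k u v → -ᴹ sP k u v ≈ᴹ sP k (λ i → -ᴹ u i) v
  -ᴹ‿distribˡ-sumProd zero    u v = ε⁻¹≈ε
  -ᴹ‿distribˡ-sumProd (suc k) u v = begin
    -ᴹ ([ head u , head v ] +ᴹ sP k (tail u) (tail v))
      ≈⟨ ⁻¹-∙-comm _ _ ⟨
    -ᴹ [ head u , head v ] +ᴹ -ᴹ sP k (tail u) (tail v)
      ≈⟨ +ᴹ-cong (≈ᴹ-sym (-ᴹ‿distribˡ-[,] _ _)) (-ᴹ‿distribˡ-sumProd k (tail u) (tail v)) ⟩
    [ -ᴹ head u , head v ] +ᴹ sP k (λ i → -ᴹ tail u i) (tail v) ∎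

  sumProd-pad : ∀ k u v → sP k u v ≈ᴹ sP (suc k) (0ᴹ ∷ u) (0ᴹ ∷ v)
  sumProd-pad k u v = ≈ᴹ-sym (≈ᴹ-trans (+ᴹ-congʳ ([,]-alt 0ᴹ)) (+ᴹ-identityˡ _))

  single : ∀ {k} → Fin k → Carrierᴹ → Fin k → Carrierᴹ
  single zero    y zero    = y
  single zero    y (suc j) = 0ᴹ
  single (suc i) y zero    = 0ᴹ
  single (suc i) y (suc j) = single i y j

  sumProd-single : ∀ k u i y → [ u i , y ] ≈ᴹ sP k u (single i y)
  sumProd-single (suc k) u zero y =
    ≈ᴹ-sym (≈ᴹ-trans (+ᴹ-congˡ (sumProd-zeroʳ k (tail u))) (+ᴹ-identityʳ _))
  sumProd-single (suc k) u (suc i) y = ≈ᴹ-trans (sumProd-single k (tail u) i y)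
    (≈ᴹ-sym (≈ᴹ-trans (+ᴹ-congʳ ([,]-zeroʳ _)) (+ᴹ-identityˡ _)))

  SumOfProducts : ℕ → Carrierᴹ → Set _
  SumOfProducts k x = Σ (Fin k → Carrierᴹ) λ u → Σ (Fin k → Carrierᴹ) λ v → x ≈ᴹ sP k u v

  SumOfProducts-resp : ∀ {k x y} → x ≈ᴹ y → SumOfProducts k x → SumOfProducts k y
  SumOfProducts-resp x≈y (u , v , e) = u , v , ≈ᴹ-trans (≈ᴹ-sym x≈y) e

  SumOfProducts-zero : ∀ k → SumOfProducts k 0ᴹ
  SumOfProducts-zero k = (λ _ → 0ᴹ) , (λ _ → 0ᴹ) , ≈ᴹ-sym (sumProd-zeroʳ k _)

  SumOfProducts-neg : ∀ {k x} → SumOfProducts k x → SumOfProducts k (-ᴹ x)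
  SumOfProducts-neg {k} (u , v , e) =
    (λ i → -ᴹ u i) , v , ≈ᴹ-trans (-ᴹ‿cong e) (-ᴹ‿distribˡ-sumProd k u v)

  SumOfProducts-≤ : ∀ {k n x} → k ≤ n → SumOfProducts k x → SumOfProducts n x
  SumOfProducts-≤ k≤n = pad (≤⇒≤′ k≤n)
    where
    pad : ∀ {k n x} → k ≤′ n → SumOfProducts k x → SumOfProducts n x
    pad ≤′-refl         s = s
    pad (≤′-step k≤′n) s with pad k≤′n s
    ... | u , v , e = (0ᴹ ∷ u) , (0ᴹ ∷ v) , ≈ᴹ-trans e (sumProd-pad _ u v)

  module _ {n : ℕ} (sentence : Sentence L n) where

    SumOfProducts-absorb : ∀ {x} p q → SumOfProducts n x → SumOfProducts n ([ p , q ] +ᴹ x)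
    SumOfProducts-absorb p q (u , v , e) with sentence (p ∷ u) (q ∷ v)
    ... | u′ , v′ , e′ = u′ , v′ , ≈ᴹ-trans (+ᴹ-congˡ e) e′

    SumOfProducts-absorbSum : ∀ {x} k u v → SumOfProducts n x → SumOfProducts n (sP k u v +ᴹ x)
    SumOfProducts-absorbSum zero    u v s = SumOfProducts-resp (≈ᴹ-sym (+ᴹ-identityˡ _)) s
    SumOfProducts-absorbSum (suc k) u v s = SumOfProducts-resp (≈ᴹ-sym (+ᴹ-assoc _ _ _))
      (SumOfProducts-absorb (head u) (head v) (SumOfProducts-absorbSum k (tail u) (tail v) s))

    SumOfProducts-+ : ∀ {x y} → SumOfProducts n x → SumOfProducts n y → SumOfProducts n (x +ᴹ y)
    SumOfProducts-+ (u , v , e) s =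
      SumOfProducts-resp (+ᴹ-congʳ (≈ᴹ-sym e)) (SumOfProducts-absorbSum n u v s)

    sentence⇒widthBound : WidthBound L n
    sentence⇒widthBound _ (l2-prod p q) = SumOfProducts-resp (+ᴹ-identityʳ _)
      (SumOfProducts-absorb p q (SumOfProducts-zero n))
    sentence⇒widthBound _ l2-zero       = SumOfProducts-zero n
    sentence⇒widthBound _ (l2-add x y)  =
      SumOfProducts-+ (sentence⇒widthBound _ x) (sentence⇒widthBound _ y)
    sentence⇒widthBound _ (l2-neg x)    = SumOfProducts-neg (sentence⇒widthBound _ x)
    sentence⇒widthBound _ (l2-resp e x) = SumOfProducts-resp e (sentence⇒widthBound _ x)

  widthAtMost⇒sentence : ∀ n → WidthAtMost L n → Sentence L n
  widthAtMost⇒sentence n (k , k≤n , widthBound) u v =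
    SumOfProducts-≤ k≤n (widthBound _ (sumProd-InL2 (suc n) u v))

  module _ {n : ℕ} (g : Fin n → Carrierᴹ) where

    InBracketSum : Carrierᴹ → Set _
    InBracketSum x = Σ (Fin n → Carrierᴹ) λ w → x ≈ᴹ sP n g w

    InBracketSum-resp : ∀ {x y} → x ≈ᴹ y → InBracketSum x → InBracketSum y
    InBracketSum-resp x≈y (w , e) = w , ≈ᴹ-trans (≈ᴹ-sym x≈y) e

    InBracketSum-zero : InBracketSum 0ᴹ
    InBracketSum-zero = (λ _ → 0ᴹ) , ≈ᴹ-sym (sumProd-zeroʳ n g)

    InBracketSum-+ : ∀ {x y} → InBracketSum x → InBracketSum y → InBracketSum (x +ᴹ y)
    InBracketSum-+ (w , e) (w′ , e′) = _ , ≈ᴹ-trans (+ᴹ-cong e e′) (sumProd-+ʳ n g w w′)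

    InSubalg⇒bracket-InBracketSum : ∀ {x} → InSubalg L g x → ∀ y → InBracketSum [ x , y ]
    InSubalg⇒bracket-InBracketSum (sa-gen i) y = single i y , sumProd-single n g i y
    InSubalg⇒bracket-InBracketSum sa-zero y =
      InBracketSum-resp (≈ᴹ-sym ([,]-zeroˡ y)) InBracketSum-zero
    InSubalg⇒bracket-InBracketSum (sa-add a b) y = InBracketSum-resp (≈ᴹ-sym ([,]-+ˡ _ _ y))
      (InBracketSum-+ (InSubalg⇒bracket-InBracketSum a y) (InSubalg⇒bracket-InBracketSum b y))
    InSubalg⇒bracket-InBracketSum (sa-neg a) y = InBracketSum-resp (≈ᴹ-sym ([-,]≈[,-] _ y))
      (InSubalg⇒bracket-InBracketSum a (-ᴹ y))
    InSubalg⇒bracket-InBracketSum (sa-scal c a) y =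
      InBracketSum-resp (≈ᴹ-sym ([*ₗ,]≈[,*ₗ] c _ y)) (InSubalg⇒bracket-InBracketSum a (c *ₗ y))
    InSubalg⇒bracket-InBracketSum (sa-br {a} {b} a∈ b∈) y =
      InBracketSum-resp (≈ᴹ-sym ([[,],]-jacobi a b y))
        (InBracketSum-+ (InSubalg⇒bracket-InBracketSum a∈ [ b , y ])
                        (InSubalg⇒bracket-InBracketSum b∈ [ y , a ]))
    InSubalg⇒bracket-InBracketSum (sa-resp e a) y =
      InBracketSum-resp ([,]-cong e ≈ᴹ-refl) (InSubalg⇒bracket-InBracketSum a y)

    generatedBy⇒ψ : GeneratedBy L g → ψ L n g
    generatedBy⇒ψ generated u v = sumProd-InBracketSum (suc n) u v
      where
      sumProd-InBracketSum : ∀ k u v → InBracketSum (sP k u v)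
      sumProd-InBracketSum zero    u v = InBracketSum-zero
      sumProd-InBracketSum (suc k) u v = InBracketSum-+
        (InSubalg⇒bracket-InBracketSum (generated (head u)) (head v))
        (sumProd-InBracketSum k (tail u) (tail v))

  module _ {n : ℕ} {a : Fin n → Carrierᴹ} (ψa : ψ L n a) where

    ψ⇒sentence : Sentence L n
    ψ⇒sentence u v with ψa u v
    ... | v′ , e = a , v′ , e

    ψ⇒InL2⇔S : ∀ y → InL2 L y ⇔ S L n y
    ψ⇒InL2⇔S y = mk⇔ InL2⇒S S⇒InL2
      where
      InL2⇒S : InL2 L y → S L n y
      InL2⇒S y∈ with sentence⇒widthBound ψ⇒sentence y y∈
      ... | u , v , e with ψa (0ᴹ ∷ u) (0ᴹ ∷ v)
      ... | v′ , e′ = a , v′ , ψa , ≈ᴹ-trans e (≈ᴹ-trans (sumProd-pad n u v) e′)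

      S⇒InL2 : S L n y → InL2 L y
      S⇒InL2 (a′ , v , _ , e) = l2-resp (≈ᴹ-sym e) (sumProd-InL2 n a′ v)

lemma2p8 : ∀ {r ℓr m ℓm : Level} {R : CommutativeRing r ℓr} (L : LieAlgebra R m ℓm)
           (n : ℕ) → 1 ≤ n →
           (Sentence L n ⇔ WidthAtMost L n)
           × ((g : Fin n → LieAlgebra.Carrierᴹ L) → GeneratedBy L g → ψ L n g)
           × ((a : Fin n → LieAlgebra.Carrierᴹ L) → ψ L n a →
                WidthAtMost L n × (∀ y → InL2 L y ⇔ S L n y))
lemma2p8 L n _ =
  mk⇔ widthAtMost (widthAtMost⇒sentence L n) ,
  (λ g → generatedBy⇒ψ L g) ,
  (λ a ψa → widthAtMost (ψ⇒sentence L ψa) , ψ⇒InL2⇔S L ψa)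
  where
  widthAtMost : Sentence L n → WidthAtMost L n
  widthAtMost sentence = n , ≤-refl , sentence⇒widthBound L sentence
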